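{- Let $\Delta$ be a 3-colored simplicial complex with $f_{12}(\Delta)\le f_{13}(\Delta)\le f_{23}(\Delta)$. Suppose that $\mathcal{D}(\Delta)\neq\emptyset$ and that there is a complex $\Gamma\in\mathcal{F}(\Delta)$ with $g_1(\Gamma)=b_1(\Delta)$ and $r(\Gamma)=2$. Then $f_1(\Delta)\ge b_1(\Delta)$. Furthermore, if $f_1(\Delta)=b_1(\Delta)$, then $g_2(\Gamma)=f_{12}(\Delta)/f_1(\Delta)$. If $f_1(\Delta)>b_1(\Delta)$, then (1) $f_{13}(\Delta)\le f_3(\Delta)(b_1(\Delta)+1)$; (2) $g_2(\Gamma)\ge f_{12}(\Delta)/f_1(\Delta)$; (3) $g_2(\Gamma)\ge f_{12}(\Delta)/(b_1(\Delta)+1)$; (4) $g_2(\Gamma)\ge f_{23}(\Delta)\big/\big(\lfloor f_{13}(\Delta)/b_1(\Delta)\rfloor+1\big)$; (5) $g_2(\Gamma)\ge f_{23}(\Delta)/f_3(\Delta)$; (6) $g_2(\Gamma)\le f_{12}(\Delta)/b_1(\Delta)$; (7) $g_2(\Gamma)\le f_{23}(\Delta)\big/\big(\lceil f_{13}(\Delta)/(b_1(\Delta)+1)\rceil-1\big)$; (8) $g_2(\Gamma)\le f_2(\Delta)$.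
   Context: A 3-colored simplicial complex is a finite simplicial complex with a coloring of its vertices by $[3]=\{1,2,3\}$ such that no face contains two vertices of the same color. $f_S(\Delta)$ is the number of faces with color set exactly $S\subseteq[3]$ (written $f_1,f_{12},f_{123}$, etc.; $f_{ij}=f_{\{i,j\}}$). Faces with color set $[3]$ are facets. Complexes are assumed to have $f_S>0$ for all $S$. Vertices of color $i$ are labeled $v^i_1,v^i_2,\dots$. Define $b_1(\Delta)=\lfloor\sqrt{f_{12}f_{13}/f_{23}}\rfloor$, $b_2(\Delta)=\lfloor\sqrt{f_{12}f_{23}/f_{13}}\rfloor$, $b_3(\Delta)=\lfloor\sqrt{f_{13}f_{23}/f_{12}}\rfloor$ (all $f$'s of $\Delta$). Construction: given $\Delta$, positive integers $g_1,g_2,g_3$ and distinct $p,q\in[3]$, build $\Gamma$ as follows. Start with vertices $v^i_1,\dots,v^i_{g_i}$ for each $i$, every two of distinct colors adjacent. If $f_p(\Delta)>g_p$, add $v^p_{g_p+1}$ and, for each color $c\ne p$, join it to the first $k_c$ present vertices of color $c$, with $k_c$ as large as possible so that the number of edges of color set $\{p,c\}$ does not exceed $f_{pc}(\Delta)$. Then, if $f_q(\Delta)>g_q$, add $v^q_{g_q+1}$ and join it in the same way (the present vertices of color $p$ including $v^p_{g_p+1}$ if added). Faces: empty set, vertices, edges, all triples of pairwise adjacent vertices. Write $g_i(\Gamma),p(\Gamma),q(\Gamma)$ for the parameters and $r(\Gamma)=6-p(\Gamma)-q(\Gamma)$. $\mathcal{A}(\Delta)$ is the set of all complexes (with parameters)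 so constructed that are well defined and satisfy $f_S(\Gamma)\le f_S(\Delta)$ for all $S\ne[3]$. $m(\Delta)=\max\{f_{123}(\Gamma):\Gamma\in\mathcal{A}(\Delta)\}$; $\mathcal{B}(\Delta)=\{\Gamma\in\mathcal{A}(\Delta):f_{123}(\Gamma)=m(\Delta)\}$; $n(\Delta)=\max\{f_{12}(\Gamma)+f_{13}(\Gamma)+f_{23}(\Gamma):\Gamma\in\mathcal{B}(\Delta)\}$; $\mathcal{C}(\Delta)=\{\Gamma\in\mathcal{B}(\Delta):f_{12}(\Gamma)+f_{13}(\Gamma)+f_{23}(\Gamma)=n(\Delta)\}$; $\mathcal{D}(\Delta)=\{\Gamma\in\mathcal{C}(\Delta): f_{123}(\Gamma)<\min\{f_1(\Delta)f_{23}(\Delta),f_2(\Delta)f_{13}(\Delta),f_3(\Delta)f_{12}(\Delta)\}\}$. $\mathcal{F}(\Delta)$ is the set of $\Gamma$ such that $\Gamma\in\mathcal{A}(\Delta)$, $f_{12}(\Gamma)+f_{13}(\Gamma)+f_{23}(\Gamma)=f_{12}(\Delta)+f_{13}(\Delta)+f_{23}(\Delta)$, $\mathcal{D}(\Delta)\neq\emptyset$, and $g_i(\Gamma)=b_i(\Delta)$ for some $i\in[3]$. -}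

module Defs where

open import Data.Nat using (ℕ; zero; suc; _+_; _*_; _∸_; _≤_; _<_; _⊔_; _⊓_; _≤ᵇ_; _<ᵇ_; _≡ᵇ_; NonZero)
open import Data.Nat.DivMod using (_/_)
open import Data.Bool using (Bool; true; false; _∧_; if_then_else_; T)
open import Data.Maybe using (Maybe; just; nothing; is-just)
open import Data.Fin using (Fin; toℕ) renaming (zero to fz; suc to fs)
open import Data.Fin.Subset using (Subset; ⁅_⁆; _∪_; ⊤)
open import Data.Vec using (Vec; _∷_; [])
open import Data.List using (List; _∷_; []; map; cartesianProduct; length)
open import Data.List.Base using (allFin)
open import Data.Product using (_×_; _,_; Σ; ∃; ∃-syntax)
open import Relation.Binary.PropositionalEquality using (_≡_; _≢_)
open import Relation.Nullary using (does)
import Data.Fin as F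

-- Colours.  Colour 1,2,3 of the paper are c₁ = 0, c₂ = 1, c₃ = 2 in Fin 3.

Color : Set
Color = Fin 3

c₁ c₂ c₃ : Color
c₁ = fz
c₂ = fs fz
c₃ = fs (fs fz)

_=ᶜ_ : Color → Color → Bool
i =ᶜ j = does (i F.≟ j)

num : Color → ℕ
num i = suc (toℕ i)

-- Faces of a 3-coloured complex whose colour-i vertices are
-- v^i_1,…,v^i_{n i}, represented by Fin (n i).  A face picks, for each
-- colour, at most one vertex (so no face has two vertices of one colour).

Face : (Color → ℕ) → Set
Face n = Maybe (Fin (n c₁)) × Maybe (Fin (n c₂)) × Maybe (Fin (n c₃))

colors : ∀ n → Face n → Subset 3
colors _ (a , b , c) = is-just a ∷ is-just b ∷ is-just c ∷ []

data _≼ᵐ_ {A : Set} : Maybe A → Maybe A → Set where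
  none≼ : ∀ {m} → nothing ≼ᵐ m
  same≼ : ∀ {x} → just x ≼ᵐ just x

subface : ∀ n → Face n → Face n → Set
subface _ (a , b , c) (a' , b' , c') = (a ≼ᵐ a') × (b ≼ᵐ b') × (c ≼ᵐ c')

record PreComplex : Set where
  field
    n    : Color → ℕ
    face : Face n → Bool

record Complex : Set where
  field
    pre    : PreComplex
    closed : ∀ (φ ψ : Face (PreComplex.n pre)) → subface (PreComplex.n pre) ψ φ →
             T (PreComplex.face pre φ) → T (PreComplex.face pre ψ)

options : (m : ℕ) → List (Maybe (Fin m))
options m = nothing ∷ map just (allFin m)

allFaces : (n : Color → ℕ) → List (Face n)
allFaces n = cartesianProduct (options (n c₁))
               (cartesianProduct (options (n c₂)) (options (n c₃)))

countᵇ : {A : Set} → (A → Bool) → List A → ℕ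
countᵇ P []       = 0
countᵇ P (x ∷ xs) = if P x then suc (countᵇ P xs) else countᵇ P xs

sameSet : Subset 3 → Subset 3 → Bool
sameSet S T' = does (Data.Vec.Properties.≡-dec Data.Bool._≟_ S T')
  where import Data.Vec.Properties
        import Data.Bool

fP : Subset 3 → PreComplex → ℕ
fP S X = countᵇ (λ φ → PreComplex.face X φ ∧ sameSet (colors (PreComplex.n X) φ) S)
                (allFaces (PreComplex.n X))

f : Subset 3 → Complex → ℕ
f S Δ = fP S (Complex.pre Δ)

f₁ : Color → PreComplex → ℕ
f₁ i = fP ⁅ i ⁆

f₂ : Color → Color → PreComplex → ℕ
f₂ i j = fP (⁅ i ⁆ ∪ ⁅ j ⁆)

edgeSum : PreComplex → ℕ
edgeSum X = f₂ c₁ c₂ X + f₂ c₁ c₃ X + f₂ c₂ c₃ X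

-- ⌊ √(a / d) ⌋ for d > 0 : the largest b with b·b·d ≤ a
-- (such b is ≤ a, so a downward search from a finds it).

floorSqrtFrac : ℕ → ℕ → ℕ
floorSqrtFrac a d = go a
  where
  go : ℕ → ℕ
  go zero    = zero
  go (suc k) = if (suc k * suc k * d ≤ᵇ a) then suc k else go k

b : Color → Complex → ℕ
b fz Δ = floorSqrtFrac (f (⁅ c₁ ⁆ ∪ ⁅ c₂ ⁆) Δ * f (⁅ c₁ ⁆ ∪ ⁅ c₃ ⁆) Δ) (f (⁅ c₂ ⁆ ∪ ⁅ c₃ ⁆) Δ)
b (fs fz) Δ = floorSqrtFrac (f (⁅ c₁ ⁆ ∪ ⁅ c₂ ⁆) Δ * f (⁅ c₂ ⁆ ∪ ⁅ c₃ ⁆) Δ) (f (⁅ c₁ ⁆ ∪ ⁅ c₃ ⁆) Δ)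
b (fs (fs fz)) Δ = floorSqrtFrac (f (⁅ c₁ ⁆ ∪ ⁅ c₃ ⁆) Δ * f (⁅ c₂ ⁆ ∪ ⁅ c₃ ⁆) Δ) (f (⁅ c₁ ⁆ ∪ ⁅ c₂ ⁆) Δ)

-- Floor / ceiling division (divisor 0 never occurs where used; the
-- zero case is a dummy value).

_div_ : ℕ → ℕ → ℕ
m div zero    = zero
m div (suc k) = m / suc k

_cdiv_ : ℕ → ℕ → ℕ
m cdiv zero    = zero
m cdiv (suc k) = (m + k) / suc k

record Params : Set where
  field
    g    : Color → ℕ
    gpos : ∀ i → 1 ≤ g i
    p q  : Color
    p≢q  : p ≢ q

r : Params → ℕ
r P = 6 ∸ num (Params.p P) ∸ num (Params.q P)

module Construction (Δ : Complex) (P : Params) where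
  open Params P

  fΔ₁ : Color → ℕ
  fΔ₁ i = f ⁅ i ⁆ Δ

  fΔ₂ : Color → Color → ℕ
  fΔ₂ i j = f (⁅ i ⁆ ∪ ⁅ j ⁆) Δ

  -- is v^p_{g_p+1} added?  is v^q_{g_q+1} added?
  addP addQ : Bool
  addP = g p <ᵇ fΔ₁ p
  addQ = g q <ᵇ fΔ₁ q

  maxK : (present existing bound : ℕ) → ℕ
  maxK present existing bound = present ⊓ (bound ∸ existing)

  -- number of colour-c vertices v^p_{g_p+1} is joined to
  kP : Color → ℕ
  kP c = maxK (g c) (g p * g c) (fΔ₂ p c)

  -- number of colour-c vertices v^q_{g_q+1} is joined to
  presentQ : Color → ℕ
  presentQ c = g c + (if (c =ᶜ p) ∧ addP then 1 else 0)

  existingQ : Color → ℕ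
  existingQ c = g q * g c + (if (c =ᶜ p) ∧ addP then kP q else 0)

  kQ : Color → ℕ
  kQ c = maxK (presentQ c) (existingQ c) (fΔ₂ q c)

  nΓ : Color → ℕ
  nΓ i = g i + (if (i =ᶜ p) ∧ addP then 1 else 0)
             + (if (i =ᶜ q) ∧ addQ then 1 else 0)

  -- a vertex is given by its colour and its 0-based index
  extraP extraQ : Color → ℕ → Bool
  extraP i a = (i =ᶜ p) ∧ (a ≡ᵇ g p)
  extraQ i a = (i =ᶜ q) ∧ (a ≡ᵇ g q)

  -- the join condition imposed by vertex x on vertex y
  jc : Color → ℕ → Color → ℕ → Bool
  jc i a j b' =
    if extraP i a
      then (if extraQ j b' then g p <ᵇ kQ p else b' <ᵇ kP j)
      else (if extraQ i a
              then (if extraP j b' then g p <ᵇ kQ p else b' <ᵇ kQ j)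
              else true)

  adj : Color → ℕ → Color → ℕ → Bool
  adj i a j b' = jc i a j b' ∧ jc j b' i a

  pairOK : ∀ {m m'} → Color → Maybe (Fin m) → Color → Maybe (Fin m') → Bool
  pairOK i (just a) j (just b') = adj i (toℕ a) j (toℕ b')
  pairOK i _        j _         = true

  Γ : PreComplex
  Γ = record
    { n    = nΓ
    ; face = λ { (x , y , z) → pairOK c₁ x c₂ y ∧ pairOK c₁ x c₃ z ∧ pairOK c₂ y c₃ z }
    }

Γ : Complex → Params → PreComplex
Γ Δ P = Construction.Γ Δ P

f₁₂₃ : PreComplex → ℕ
f₁₂₃ = fP ⊤

𝒜 : Complex → Params → Set
𝒜 Δ P = ∀ (S : Subset 3) → S ≢ ⊤ → fP S (Γ Δ P) ≤ f S Δ

ℬ : Complex → Params → Set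
ℬ Δ P = 𝒜 Δ P × (∀ Q → 𝒜 Δ Q → f₁₂₃ (Γ Δ Q) ≤ f₁₂₃ (Γ Δ P))

𝒞 : Complex → Params → Set
𝒞 Δ P = ℬ Δ P × (∀ Q → ℬ Δ Q → edgeSum (Γ Δ Q) ≤ edgeSum (Γ Δ P))

𝒟 : Complex → Params → Set
𝒟 Δ P = 𝒞 Δ P ×
  (f₁₂₃ (Γ Δ P) < (f₁ c₁ D * f₂ c₂ c₃ D) ⊓ (f₁ c₂ D * f₂ c₁ c₃ D) ⊓ (f₁ c₃ D * f₂ c₁ c₂ D))
  where D = Complex.pre Δ

ℱ : Complex → Params → Set
ℱ Δ P = 𝒜 Δ P × (edgeSum (Γ Δ P) ≡ edgeSum (Complex.pre Δ)) ×
        (∃[ Q ] 𝒟 Δ Q) × (∃[ i ] Params.g P i ≡ b i Δ)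

-- Write n_i for the number of colour-i vertices of Γ.  Γ contains the complete
-- g₁ × g₂ × g₃ box, so g_i g_j ≤ f_{ij}(Γ) ≤ f_{ij}(Δ), while f_{ij}(Γ) ≤ n_i n_j.
-- As Γ ∈ 𝒜 and the edge totals of Γ and Δ agree, in fact f_{ij}(Γ) = f_{ij}(Δ).
-- Only colours p and q can receive an extra vertex, and only when g_i < f_i(Δ), so
-- n_i ≤ g_i + 1, n_i = g_i if f_i(Δ) ≤ g_i, and n_i ≤ f_i(Δ); r(Γ) = 2 forces
-- {p, q} = {1, 3}, so n₂ = g₂.  Every claim is arithmetic on these bounds.
module Submission where

open import Defs
open import Data.Bool using (Bool; true; false; _∧_; T)
open import Data.Bool.Properties using (T-∧)
open import Data.Empty using (⊥-elim)
open import Data.Fin using (Fin; toℕ) renaming (zero to fz; suc to fs)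
open import Data.Fin.Properties using (toℕ<n)
import Data.Fin as Fin
open import Data.Fin.Subset using (Subset; ⁅_⁆; _∪_; ⊤)
open import Data.List using (List; []; _∷_; _++_; map; cartesianProduct; allFin; tabulate)
open import Data.List.Properties using (map-tabulate)
open import Data.Maybe using (Maybe; just; nothing; is-just)
open import Data.Nat
open import Data.Nat.DivMod using (_/_; m*n/n≡m; /-monoˡ-≤; m<n*o⇒m/o<n)
open import Data.Nat.Properties
open import Data.Product using (_×_; _,_; proj₁; proj₂; ∃-syntax)
open import Data.Sum using (_⊎_; inj₁; inj₂)
open import Data.Vec using (_∷_; [])
open import Function using (_∘_)
open import Function.Bundles using (Equivalence)
open import Relation.Binary.PropositionalEquality
open import Relation.Nullary using (does; yes; no)
open import Relation.Nullary.Decidable using (dec-false)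
import Data.Bool as Bool

open Equivalence using (to; from)

countᵇ-++ : ∀ {A : Set} (P : A → Bool) (xs ys : List A) →
            countᵇ P (xs ++ ys) ≡ countᵇ P xs + countᵇ P ys
countᵇ-++ P []       ys = refl
countᵇ-++ P (x ∷ xs) ys with P x
... | true  = cong suc (countᵇ-++ P xs ys)
... | false = countᵇ-++ P xs ys

countᵇ-map : ∀ {A B : Set} (P : B → Bool) (h : A → B) (xs : List A) →
             countᵇ P (map h xs) ≡ countᵇ (P ∘ h) xs
countᵇ-map P h []       = refl
countᵇ-map P h (x ∷ xs) with P (h x)
... | true  = cong suc (countᵇ-map P h xs)
... | false = countᵇ-map P h xs

countᵇ-false : ∀ {A : Set} (xs : List A) → countᵇ (λ _ → false) xs ≡ 0
countᵇ-false []       = refl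
countᵇ-false (x ∷ xs) = countᵇ-false xs

countᵇ-mono : ∀ {A : Set} {P Q : A → Bool} → (∀ x → T (P x) → T (Q x)) →
              (xs : List A) → countᵇ P xs ≤ countᵇ Q xs
countᵇ-mono P⇒Q [] = z≤n
countᵇ-mono {P = P} {Q} P⇒Q (x ∷ xs) with P x | Q x | P⇒Q x
... | true  | true  | _   = s≤s (countᵇ-mono P⇒Q xs)
... | true  | false | P⇒Q = ⊥-elim (P⇒Q _)
... | false | true  | _   = m≤n⇒m≤1+n (countᵇ-mono P⇒Q xs)
... | false | false | _   = countᵇ-mono P⇒Q xs

countᵇ-cartesianProduct :
  ∀ {A B : Set} (P : A → Bool) (Q : B → Bool) (xs : List A) (ys : List B) →
  countᵇ (λ (x , y) → P x ∧ Q y) (cartesianProduct xs ys) ≡ countᵇ P xs * countᵇ Q ys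
countᵇ-cartesianProduct P Q []       ys = refl
countᵇ-cartesianProduct P Q (x ∷ xs) ys = begin
  countᵇ R (map (x ,_) ys ++ cartesianProduct xs ys)
    ≡⟨ countᵇ-++ R (map (x ,_) ys) (cartesianProduct xs ys) ⟩
  countᵇ R (map (x ,_) ys) + countᵇ R (cartesianProduct xs ys)
    ≡⟨ cong₂ _+_ (countᵇ-map R (x ,_) ys) (countᵇ-cartesianProduct P Q xs ys) ⟩
  countᵇ (λ y → P x ∧ Q y) ys + countᵇ P xs * countᵇ Q ys
    ≡⟨ row (P x) ⟩
  countᵇ P (x ∷ xs) * countᵇ Q ys ∎
  where
  open ≡-Reasoning
  R = λ (x , y) → P x ∧ Q y
  row : ∀ b → countᵇ (λ y → b ∧ Q y) ys + countᵇ P xs * countᵇ Q ys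
            ≡ (Bool.if b then suc (countᵇ P xs) else countᵇ P xs) * countᵇ Q ys
  row true  = refl
  row false = cong (_+ countᵇ P xs * countᵇ Q ys) (countᵇ-false ys)

countᵇ-<ᵇ : ∀ {k m} → k ≤ m → countᵇ (λ a → toℕ a <ᵇ k) (allFin m) ≡ k
countᵇ-<ᵇ {zero}  {m}     _         = countᵇ-false (allFin m)
countᵇ-<ᵇ {suc k} {suc m} (s≤s k≤m) = cong suc (begin
  countᵇ below (tabulate fs)               ≡⟨ cong (countᵇ below) (sym (map-tabulate (λ a → a) fs)) ⟩
  countᵇ below (map fs (allFin m))         ≡⟨ countᵇ-map below fs (allFin m) ⟩
  countᵇ (λ a → toℕ a <ᵇ k) (allFin m)    ≡⟨ countᵇ-<ᵇ k≤m ⟩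
  k                                        ∎)
  where
  open ≡-Reasoning
  below : Fin (suc m) → Bool
  below a = toℕ a <ᵇ suc k

slot : ∀ {m} → Bool → ℕ → Maybe (Fin m) → Bool
slot false _ nothing  = true
slot false _ (just _) = false
slot true  _ nothing  = false
slot true  k (just a) = toℕ a <ᵇ k

box : ∀ {n} → Subset 3 → (Color → ℕ) → Face n → Bool
box (s₁ ∷ s₂ ∷ s₃ ∷ []) k (x , y , z) = slot s₁ (k c₁) x ∧ (slot s₂ (k c₂) y ∧ slot s₃ (k c₃) z)

size : Bool → ℕ → ℕ
size false _ = 1
size true  k = k

gridSize : Subset 3 → (Color → ℕ) → ℕ
gridSize (s₁ ∷ s₂ ∷ s₃ ∷ []) k = size s₁ (k c₁) * (size s₂ (k c₂) * size s₃ (k c₃))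

countᵇ-slot : ∀ s {k m} → k ≤ m → countᵇ (slot s k) (options m) ≡ size s k
countᵇ-slot false {k} {m} _   =
  cong suc (trans (countᵇ-map (slot false k) just (allFin m)) (countᵇ-false (allFin m)))
countᵇ-slot true  {k} {m} k≤m =
  trans (countᵇ-map (slot true k) just (allFin m)) (countᵇ-<ᵇ k≤m)

countᵇ-box : ∀ S {k n} → (∀ i → k i ≤ n i) → countᵇ (box {n} S k) (allFaces n) ≡ gridSize S k
countᵇ-box (s₁ ∷ s₂ ∷ s₃ ∷ []) {k} {n} k≤n = begin
  countᵇ (box {n} (s₁ ∷ s₂ ∷ s₃ ∷ []) k) (allFaces n)
    ≡⟨ countᵇ-cartesianProduct (slot s₁ (k c₁)) slot₂₃ (o c₁) (cartesianProduct (o c₂) (o c₃)) ⟩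
  countᵇ (slot s₁ (k c₁)) (o c₁) * countᵇ slot₂₃ (cartesianProduct (o c₂) (o c₃))
    ≡⟨ cong (countᵇ (slot s₁ (k c₁)) (o c₁) *_)
            (countᵇ-cartesianProduct (slot s₂ (k c₂)) (slot s₃ (k c₃)) (o c₂) (o c₃)) ⟩
  countᵇ (slot s₁ (k c₁)) (o c₁) * (countᵇ (slot s₂ (k c₂)) (o c₂) * countᵇ (slot s₃ (k c₃)) (o c₃))
    ≡⟨ cong₂ _*_ (countᵇ-slot s₁ (k≤n c₁)) (cong₂ _*_ (countᵇ-slot s₂ (k≤n c₂)) (countᵇ-slot s₃ (k≤n c₃))) ⟩
  gridSize (s₁ ∷ s₂ ∷ s₃ ∷ []) k ∎
  where
  open ≡-Reasoning
  o : (i : Color) → List (Maybe (Fin (n i)))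
  o i = options (n i)
  slot₂₃ : Maybe (Fin (n c₂)) × Maybe (Fin (n c₃)) → Bool
  slot₂₃ (y , z) = slot s₂ (k c₂) y ∧ slot s₃ (k c₃) z

colour⇒slot : ∀ s {m} (x : Maybe (Fin m)) → T (does (is-just x Bool.≟ s)) → T (slot s m x)
colour⇒slot false nothing  _ = _
colour⇒slot true  (just a) _ = <⇒<ᵇ (toℕ<n a)

slot⇒colour : ∀ s {k m} (x : Maybe (Fin m)) → T (slot s k x) → T (does (is-just x Bool.≟ s))
slot⇒colour false nothing  _ = _
slot⇒colour true  (just a) _ = _

sameSet⇒box : ∀ {n} S (φ : Face n) → T (sameSet (colors n φ) S) → T (box {n} S n φ)
sameSet⇒box (s₁ ∷ s₂ ∷ s₃ ∷ []) (x , y , z) t =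
  let (t₁ , t₂₃) = to T-∧ t ; (t₂ , t₃₊) = to T-∧ t₂₃ ; (t₃ , _) = to T-∧ t₃₊
  in from T-∧ (colour⇒slot s₁ x t₁ , from T-∧ (colour⇒slot s₂ y t₂ , colour⇒slot s₃ z t₃))

box⇒sameSet : ∀ {n} S k (φ : Face n) → T (box {n} S k φ) → T (sameSet (colors n φ) S)
box⇒sameSet (s₁ ∷ s₂ ∷ s₃ ∷ []) k (x , y , z) t =
  let (t₁ , t₂₃) = to T-∧ t ; (t₂ , t₃) = to T-∧ t₂₃
  in from T-∧ (slot⇒colour s₁ x t₁ , from T-∧ (slot⇒colour s₂ y t₂ , from T-∧ (slot⇒colour s₃ z t₃ , _)))

fP≤gridSize : ∀ S X → fP S X ≤ gridSize S (PreComplex.n X)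
fP≤gridSize S X = begin
  fP S X
    ≤⟨ countᵇ-mono (λ φ t → sameSet⇒box S φ (proj₂ (to T-∧ t))) (allFaces n) ⟩
  countᵇ (box {n} S n) (allFaces n)
    ≡⟨ countᵇ-box S (λ _ → ≤-refl) ⟩
  gridSize S n ∎
  where
  open ≤-Reasoning
  n = PreComplex.n X

gridSize≤fP : ∀ S X {k} → (∀ i → k i ≤ PreComplex.n X i) →
              (∀ φ → T (box {PreComplex.n X} S k φ) → T (PreComplex.face X φ)) → gridSize S k ≤ fP S X
gridSize≤fP S X {k} k≤n box⊆X = begin
  gridSize S k
    ≡⟨ countᵇ-box S k≤n ⟨
  countᵇ (box {n} S k) (allFaces n)
    ≤⟨ countᵇ-mono (λ φ t → from T-∧ (box⊆X φ t , box⇒sameSet S k φ t)) (allFaces n) ⟩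
  fP S X ∎
  where
  open ≤-Reasoning
  n = PreComplex.n X

gridSize-⁅⁆ : ∀ i k → gridSize ⁅ i ⁆ k ≡ k i
gridSize-⁅⁆ fz           k = *-identityʳ (k c₁)
gridSize-⁅⁆ (fs fz)      k = trans (*-identityˡ _) (*-identityʳ (k c₂))
gridSize-⁅⁆ (fs (fs fz)) k = trans (*-identityˡ _) (*-identityˡ (k c₃))

gridSize-⁅⁆∪⁅⁆ : ∀ {i j} k → i ≢ j → gridSize (⁅ i ⁆ ∪ ⁅ j ⁆) k ≡ k i * k j
gridSize-⁅⁆∪⁅⁆ {fz}           {fz}           k i≢j = ⊥-elim (i≢j refl)
gridSize-⁅⁆∪⁅⁆ {fz}           {fs fz}        k _   = cong (k c₁ *_) (*-identityʳ (k c₂))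
gridSize-⁅⁆∪⁅⁆ {fz}           {fs (fs fz)}   k _   = cong (k c₁ *_) (*-identityˡ (k c₃))
gridSize-⁅⁆∪⁅⁆ {fs fz}        {fz}           k _   = trans (cong (k c₁ *_) (*-identityʳ (k c₂))) (*-comm (k c₁) (k c₂))
gridSize-⁅⁆∪⁅⁆ {fs fz}        {fs fz}        k i≢j = ⊥-elim (i≢j refl)
gridSize-⁅⁆∪⁅⁆ {fs fz}        {fs (fs fz)}   k _   = *-identityˡ (k c₂ * k c₃)
gridSize-⁅⁆∪⁅⁆ {fs (fs fz)}   {fz}           k _   = trans (cong (k c₁ *_) (*-identityˡ (k c₃))) (*-comm (k c₁) (k c₃))
gridSize-⁅⁆∪⁅⁆ {fs (fs fz)}   {fs fz}        k _   = trans (*-identityˡ (k c₂ * k c₃)) (*-comm (k c₂) (k c₃))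
gridSize-⁅⁆∪⁅⁆ {fs (fs fz)}   {fs (fs fz)}   k i≢j = ⊥-elim (i≢j refl)

f₂≤n*n : ∀ X {i j} → i ≢ j → f₂ i j X ≤ PreComplex.n X i * PreComplex.n X j
f₂≤n*n X {i} {j} i≢j =
  subst (f₂ i j X ≤_) (gridSize-⁅⁆∪⁅⁆ (PreComplex.n X) i≢j) (fP≤gridSize (⁅ i ⁆ ∪ ⁅ j ⁆) X)

module _ (Δ : Complex) (P : Params) where
  open Params P
  open Construction Δ P hiding (Γ)

  -- extraP and extraQ are the instances c = p and c = q.
  unmarked-below-g : ∀ c i a → a < g i → ((i =ᶜ c) ∧ (a ≡ᵇ g c)) ≡ false
  unmarked-below-g c i a a<g with i Fin.≟ c
  ... | yes refl = dec-false (a ≟ g i) (<⇒≢ a<g)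
  ... | no _     = refl

  jc-below-g : ∀ i a j b → a < g i → jc i a j b ≡ true
  jc-below-g i a j b a<g rewrite unmarked-below-g p i a a<g | unmarked-below-g q i a a<g = refl

  adj-below-g : ∀ i a j b → a < g i → b < g j → T (adj i a j b)
  adj-below-g i a j b a<g b<g rewrite jc-below-g i a j b a<g | jc-below-g j b i a b<g = _

  pairOK-below-g : ∀ {s t} i j {m m'} (x : Maybe (Fin m)) (y : Maybe (Fin m')) →
                   T (slot s (g i) x) → T (slot t (g j) y) → T (pairOK i x j y)
  pairOK-below-g                 i j nothing  y        _   _   = _
  pairOK-below-g                 i j (just a) nothing  _   _   = _
  pairOK-below-g {false}         i j (just a) (just b) ()  _
  pairOK-below-g {true}  {false} i j (just a) (just b) _   ()
  pairOK-below-g {true}  {true}  i j (just a) (just b) a<g b<g =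
    adj-below-g i (toℕ a) j (toℕ b) (<ᵇ⇒< _ _ a<g) (<ᵇ⇒< _ _ b<g)

  box-g⊆Γ : ∀ S φ → T (box {nΓ} S g φ) → T (PreComplex.face (Γ Δ P) φ)
  box-g⊆Γ (s₁ ∷ s₂ ∷ s₃ ∷ []) (x , y , z) t =
    let (t₁ , t₂₃) = to T-∧ t ; (t₂ , t₃) = to T-∧ t₂₃
    in from T-∧ ( pairOK-below-g {s₁} {s₂} c₁ c₂ x y t₁ t₂
                , from T-∧ ( pairOK-below-g {s₁} {s₃} c₁ c₃ x z t₁ t₃
                                , pairOK-below-g {s₂} {s₃} c₂ c₃ y z t₂ t₃))

  g≤nΓ : ∀ i → g i ≤ nΓ i
  g≤nΓ i = ≤-trans (m≤m+n (g i) _) (m≤m+n _ _)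

  nΓ≡g⊎nΓ≡g+1 : ∀ i → nΓ i ≡ g i ⊎ (nΓ i ≡ g i + 1 × g i < fΔ₁ i)
  nΓ≡g⊎nΓ≡g+1 i with i Fin.≟ p | i Fin.≟ q
  ... | yes refl | yes refl = ⊥-elim (p≢q refl)
  ... | yes refl | no _ with g p <ᵇ fΔ₁ p | <ᵇ⇒< (g p) (fΔ₁ p)
  ...   | true  | g<f = inj₂ (+-identityʳ _ , g<f _)
  ...   | false | _   = inj₁ (trans (+-identityʳ _) (+-identityʳ _))
  nΓ≡g⊎nΓ≡g+1 i | no _ | yes refl with g q <ᵇ fΔ₁ q | <ᵇ⇒< (g q) (fΔ₁ q)
  ...   | true  | g<f = inj₂ (cong (_+ 1) (+-identityʳ _) , g<f _)
  ...   | false | _   = inj₁ (trans (+-identityʳ _) (+-identityʳ _))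
  nΓ≡g⊎nΓ≡g+1 i | no _ | no _ = inj₁ (trans (+-identityʳ _) (+-identityʳ _))

  nΓ≤g+1 : ∀ i → nΓ i ≤ g i + 1
  nΓ≤g+1 i with nΓ≡g⊎nΓ≡g+1 i
  ... | inj₁ nΓ≡g       = ≤-trans (≤-reflexive nΓ≡g) (m≤m+n (g i) 1)
  ... | inj₂ (nΓ≡g+1 , _) = ≤-reflexive nΓ≡g+1

  nΓ≤fΔ₁ : ∀ i → g i ≤ fΔ₁ i → nΓ i ≤ fΔ₁ i
  nΓ≤fΔ₁ i g≤f with nΓ≡g⊎nΓ≡g+1 i
  ... | inj₁ nΓ≡g           = subst (_≤ fΔ₁ i) (sym nΓ≡g) g≤f
  ... | inj₂ (nΓ≡g+1 , g<f) = subst (_≤ fΔ₁ i) (sym (trans nΓ≡g+1 (+-comm (g i) 1))) g<f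

  nΓ≡g : ∀ i → fΔ₁ i ≤ g i → nΓ i ≡ g i
  nΓ≡g i f≤g with nΓ≡g⊎nΓ≡g+1 i
  ... | inj₁ nΓ≡g     = nΓ≡g
  ... | inj₂ (_ , g<f) = ⊥-elim (<⇒≱ g<f f≤g)

  nΓ≡g-off-pq : ∀ {i} → i ≢ p → i ≢ q → nΓ i ≡ g i
  nΓ≡g-off-pq {i} i≢p i≢q rewrite dec-false (i Fin.≟ p) i≢p | dec-false (i Fin.≟ q) i≢q =
    trans (+-identityʳ _) (+-identityʳ _)

  g≤f₁Γ : ∀ i → g i ≤ f₁ i (Γ Δ P)
  g≤f₁Γ i =
    subst (_≤ f₁ i (Γ Δ P)) (gridSize-⁅⁆ i g) (gridSize≤fP ⁅ i ⁆ (Γ Δ P) g≤nΓ (box-g⊆Γ ⁅ i ⁆))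

  g*g≤f₂Γ : ∀ {i j} → i ≢ j → g i * g j ≤ f₂ i j (Γ Δ P)
  g*g≤f₂Γ {i} {j} i≢j =
    subst (_≤ f₂ i j (Γ Δ P)) (gridSize-⁅⁆∪⁅⁆ g i≢j)
          (gridSize≤fP (⁅ i ⁆ ∪ ⁅ j ⁆) (Γ Δ P) g≤nΓ (box-g⊆Γ (⁅ i ⁆ ∪ ⁅ j ⁆)))

≤-+-≡⇒≡ : ∀ {a b a' b'} → a ≤ a' → b ≤ b' → a + b ≡ a' + b' → a ≡ a' × b ≡ b'
≤-+-≡⇒≡ {a} {b} {a'} {b'} a≤a' b≤b' sum≡ =
  ≤-antisym a≤a' (+-cancelʳ-≤ b a' a (≤-trans (+-monoʳ-≤ a' b≤b') (≤-reflexive (sym sum≡)))) ,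
  ≤-antisym b≤b' (+-cancelˡ-≤ a b' b (≤-trans (+-monoˡ-≤ b' a≤a') (≤-reflexive (sym sum≡))))

*≤⇒≤div : ∀ {k m t} → 0 < k → k * t ≤ m → t ≤ m div k
*≤⇒≤div {suc k} {m} {t} _ kt≤m = begin
  t                 ≡⟨ m*n/n≡m t (suc k) ⟨
  t * suc k / suc k ≤⟨ /-monoˡ-≤ (suc k) (subst (_≤ m) (*-comm (suc k) t) kt≤m) ⟩
  m / suc k         ∎
  where open ≤-Reasoning

≤*⇒cdiv∸1≤ : ∀ k {m t} → m ≤ (k + 1) * (t + 1) → m cdiv (k + 1) ∸ 1 ≤ t
≤*⇒cdiv∸1≤ k {m} {t} m≤ rewrite +-comm k 1 | +-comm t 1 =
  ∸-monoˡ-≤ 1 (s≤s⁻¹ (m<n*o⇒m/o<n {m + k} {suc (suc t)} {suc k} m+k<))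
  where
  m+k< : m + k < suc (suc t) * suc k
  m+k< = s≤s (subst (_≤ k + suc t * suc k) (+-comm k m)
                (+-monoʳ-≤ k (subst (m ≤_) (*-comm (suc k) (suc t)) m≤)))

r≡2⇒c₂∉pq : ∀ p q → p ≢ q → 6 ∸ num p ∸ num q ≡ 2 → c₂ ≢ p × c₂ ≢ q
r≡2⇒c₂∉pq fz           fz           _   _  = (λ ()) , (λ ())
r≡2⇒c₂∉pq fz           (fs fz)      _   ()
r≡2⇒c₂∉pq fz           (fs (fs fz)) _   _  = (λ ()) , (λ ())
r≡2⇒c₂∉pq (fs fz)      fz           _   ()
r≡2⇒c₂∉pq (fs fz)      (fs fz)      p≢q _  = ⊥-elim (p≢q refl)
r≡2⇒c₂∉pq (fs fz)      (fs (fs fz)) _   ()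
r≡2⇒c₂∉pq (fs (fs fz)) fz           _   _  = (λ ()) , (λ ())
r≡2⇒c₂∉pq (fs (fs fz)) (fs fz)      _   ()
r≡2⇒c₂∉pq (fs (fs fz)) (fs (fs fz)) _   _  = (λ ()) , (λ ())

⁅⁆≢⊤ : ∀ (i : Color) → ⁅ i ⁆ ≢ ⊤
⁅⁆≢⊤ fz           ()
⁅⁆≢⊤ (fs fz)      ()
⁅⁆≢⊤ (fs (fs fz)) ()

module Estimates (Δ : Complex) (P : Params) (Γ∈𝒜 : 𝒜 Δ P)
                 (tight : edgeSum (Γ Δ P) ≡ edgeSum (Complex.pre Δ)) (r≡2 : r P ≡ 2) where
  open Params P
  open Construction Δ P using (nΓ; fΔ₁; fΔ₂)

  g₁ g₂ g₃ F₁ F₃ F₁₂ F₁₃ F₂₃ : ℕ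
  g₁ = g c₁
  g₂ = g c₂
  g₃ = g c₃
  F₁ = fΔ₁ c₁
  F₃ = fΔ₁ c₃
  F₁₂ = fΔ₂ c₁ c₂
  F₁₃ = fΔ₂ c₁ c₃
  F₂₃ = fΔ₂ c₂ c₃

  f₂Γ≤f₂Δ : ∀ {i j} → ⁅ i ⁆ ∪ ⁅ j ⁆ ≢ ⊤ → f₂ i j (Γ Δ P) ≤ fΔ₂ i j
  f₂Γ≤f₂Δ {i} {j} = Γ∈𝒜 (⁅ i ⁆ ∪ ⁅ j ⁆)

  f₂Γ≡f₂Δ : f₂ c₁ c₂ (Γ Δ P) ≡ F₁₂ × f₂ c₁ c₃ (Γ Δ P) ≡ F₁₃ × f₂ c₂ c₃ (Γ Δ P) ≡ F₂₃
  f₂Γ≡f₂Δ =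
    let (f₁₂+f₁₃≡ , f₂₃≡) = ≤-+-≡⇒≡ (+-mono-≤ f₁₂≤ f₁₃≤) f₂₃≤ tight
        (f₁₂≡ , f₁₃≡)     = ≤-+-≡⇒≡ f₁₂≤ f₁₃≤ f₁₂+f₁₃≡
    in f₁₂≡ , f₁₃≡ , f₂₃≡
    where
    f₁₂≤ = f₂Γ≤f₂Δ {c₁} {c₂} (λ ())
    f₁₃≤ = f₂Γ≤f₂Δ {c₁} {c₃} (λ ())
    f₂₃≤ = f₂Γ≤f₂Δ {c₂} {c₃} (λ ())

  nΓ₂≡g₂ : nΓ c₂ ≡ g₂
  nΓ₂≡g₂ = let (c₂≢p , c₂≢q) = r≡2⇒c₂∉pq p q p≢q r≡2 in nΓ≡g-off-pq Δ P c₂≢p c₂≢q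

  g≤fΔ₁ : ∀ i → g i ≤ fΔ₁ i
  g≤fΔ₁ i = ≤-trans (g≤f₁Γ Δ P i) (Γ∈𝒜 ⁅ i ⁆ (⁅⁆≢⊤ i))

  nΓ₃≤F₃ : nΓ c₃ ≤ F₃
  nΓ₃≤F₃ = nΓ≤fΔ₁ Δ P c₃ (g≤fΔ₁ c₃)

  F₁₂≤nΓ₁g₂ : F₁₂ ≤ nΓ c₁ * g₂
  F₁₂≤nΓ₁g₂ = subst₂ (λ e n₂ → e ≤ nΓ c₁ * n₂) (proj₁ f₂Γ≡f₂Δ) nΓ₂≡g₂ (f₂≤n*n (Γ Δ P) (λ ()))

  F₁₃≤nΓ₁nΓ₃ : F₁₃ ≤ nΓ c₁ * nΓ c₃
  F₁₃≤nΓ₁nΓ₃ = subst (_≤ nΓ c₁ * nΓ c₃) (proj₁ (proj₂ f₂Γ≡f₂Δ)) (f₂≤n*n (Γ Δ P) (λ ()))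

  F₂₃≤g₂nΓ₃ : F₂₃ ≤ g₂ * nΓ c₃
  F₂₃≤g₂nΓ₃ = subst₂ (λ e n₂ → e ≤ n₂ * nΓ c₃) (proj₂ (proj₂ f₂Γ≡f₂Δ)) nΓ₂≡g₂ (f₂≤n*n (Γ Δ P) (λ ()))

  g₁g₂≤F₁₂ : g₁ * g₂ ≤ F₁₂
  g₁g₂≤F₁₂ = ≤-trans (g*g≤f₂Γ Δ P (λ ())) (f₂Γ≤f₂Δ {c₁} {c₂} (λ ()))

  g₁g₃≤F₁₃ : g₁ * g₃ ≤ F₁₃
  g₁g₃≤F₁₃ = ≤-trans (g*g≤f₂Γ Δ P (λ ())) (f₂Γ≤f₂Δ {c₁} {c₃} (λ ()))

  g₂g₃≤F₂₃ : g₂ * g₃ ≤ F₂₃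
  g₂g₃≤F₂₃ = ≤-trans (g*g≤f₂Γ Δ P (λ ())) (f₂Γ≤f₂Δ {c₂} {c₃} (λ ()))

  F₁₂≤g₂[g₁+1] : F₁₂ ≤ g₂ * (g₁ + 1)
  F₁₂≤g₂[g₁+1] = ≤-trans F₁₂≤nΓ₁g₂
    (subst (nΓ c₁ * g₂ ≤_) (*-comm (g₁ + 1) g₂) (*-monoˡ-≤ g₂ (nΓ≤g+1 Δ P c₁)))

  F₂₃≤g₂[g₃+1] : F₂₃ ≤ g₂ * (g₃ + 1)
  F₂₃≤g₂[g₃+1] = ≤-trans F₂₃≤g₂nΓ₃ (*-monoʳ-≤ g₂ (nΓ≤g+1 Δ P c₃))

  F₁≡g₁⇒g₂F₁≡F₁₂ : F₁ ≡ g₁ → g₂ * F₁ ≡ F₁₂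
  F₁≡g₁⇒g₂F₁≡F₁₂ F₁≡g₁ = begin
    g₂ * F₁     ≡⟨ cong (g₂ *_) F₁≡g₁ ⟩
    g₂ * g₁     ≡⟨ *-comm g₂ g₁ ⟩
    g₁ * g₂     ≡⟨ ≤-antisym g₁g₂≤F₁₂ (subst (λ n₁ → F₁₂ ≤ n₁ * g₂) nΓ₁≡g₁ F₁₂≤nΓ₁g₂) ⟩
    F₁₂         ∎
    where
    open ≡-Reasoning
    nΓ₁≡g₁ : nΓ c₁ ≡ g₁
    nΓ₁≡g₁ = nΓ≡g Δ P c₁ (≤-reflexive F₁≡g₁)

  F₁₃≤F₃[g₁+1] : F₁₃ ≤ F₃ * (g₁ + 1)
  F₁₃≤F₃[g₁+1] = ≤-trans F₁₃≤nΓ₁nΓ₃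
    (subst (nΓ c₁ * nΓ c₃ ≤_) (*-comm (g₁ + 1) F₃) (*-mono-≤ (nΓ≤g+1 Δ P c₁) nΓ₃≤F₃))

  g₁<F₁⇒F₁₂≤g₂F₁ : g₁ < F₁ → F₁₂ ≤ g₂ * F₁
  g₁<F₁⇒F₁₂≤g₂F₁ g₁<F₁ = ≤-trans F₁₂≤g₂[g₁+1] (*-monoʳ-≤ g₂ (subst (_≤ F₁) (+-comm 1 g₁) g₁<F₁))

  F₂₃≤g₂[F₁₃div-g₁+1] : F₂₃ ≤ g₂ * (F₁₃ div g₁ + 1)
  F₂₃≤g₂[F₁₃div-g₁+1] = ≤-trans F₂₃≤g₂[g₃+1] (*-monoʳ-≤ g₂ (+-monoˡ-≤ 1 (*≤⇒≤div (gpos c₁) g₁g₃≤F₁₃)))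

  F₂₃≤g₂F₃ : F₂₃ ≤ g₂ * F₃
  F₂₃≤g₂F₃ = ≤-trans F₂₃≤g₂nΓ₃ (*-monoʳ-≤ g₂ nΓ₃≤F₃)

  g₂[F₁₃cdiv[g₁+1]∸1]≤F₂₃ : g₂ * (F₁₃ cdiv (g₁ + 1) ∸ 1) ≤ F₂₃
  g₂[F₁₃cdiv[g₁+1]∸1]≤F₂₃ = ≤-trans (*-monoʳ-≤ g₂ (≤*⇒cdiv∸1≤ g₁ F₁₃≤[g₁+1][g₃+1])) g₂g₃≤F₂₃
    where
    F₁₃≤[g₁+1][g₃+1] : F₁₃ ≤ (g₁ + 1) * (g₃ + 1)
    F₁₃≤[g₁+1][g₃+1] = ≤-trans F₁₃≤nΓ₁nΓ₃ (*-mono-≤ (nΓ≤g+1 Δ P c₁) (nΓ≤g+1 Δ P c₃))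

lemma2p24 : (Δ : Complex) →
    (∀ S → 0 < f S Δ) →
    f₂ c₁ c₂ (Complex.pre Δ) ≤ f₂ c₁ c₃ (Complex.pre Δ) →
    f₂ c₁ c₃ (Complex.pre Δ) ≤ f₂ c₂ c₃ (Complex.pre Δ) →
    (∃[ Q ] 𝒟 Δ Q) →
    (P : Params) → ℱ Δ P → Params.g P c₁ ≡ b c₁ Δ → r P ≡ 2 →
    (b c₁ Δ ≤ f₁ c₁ (Complex.pre Δ))
    × (f₁ c₁ (Complex.pre Δ) ≡ b c₁ Δ →
         Params.g P c₂ * f₁ c₁ (Complex.pre Δ) ≡ f₂ c₁ c₂ (Complex.pre Δ))
    × (b c₁ Δ < f₁ c₁ (Complex.pre Δ) →
         (f₂ c₁ c₃ (Complex.pre Δ) ≤ f₁ c₃ (Complex.pre Δ) * (b c₁ Δ + 1))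
       × (f₂ c₁ c₂ (Complex.pre Δ) ≤ Params.g P c₂ * f₁ c₁ (Complex.pre Δ))
       × (f₂ c₁ c₂ (Complex.pre Δ) ≤ Params.g P c₂ * (b c₁ Δ + 1))
       × (f₂ c₂ c₃ (Complex.pre Δ)
            ≤ Params.g P c₂ * ((f₂ c₁ c₃ (Complex.pre Δ) div b c₁ Δ) + 1))
       × (f₂ c₂ c₃ (Complex.pre Δ) ≤ Params.g P c₂ * f₁ c₃ (Complex.pre Δ))
       × (Params.g P c₂ * b c₁ Δ ≤ f₂ c₁ c₂ (Complex.pre Δ))
       × (Params.g P c₂ * ((f₂ c₁ c₃ (Complex.pre Δ) cdiv (b c₁ Δ + 1)) ∸ 1)
            ≤ f₂ c₂ c₃ (Complex.pre Δ))
       × (Params.g P c₂ ≤ f₁ c₂ (Complex.pre Δ)))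
lemma2p24 Δ _ _ _ _ P (Γ∈𝒜 , tight , _ , _) g₁≡b₁ r≡2 =
  at (_≤ F₁) (g≤fΔ₁ c₁) ,
  (λ F₁≡b₁ → F₁≡g₁⇒g₂F₁≡F₁₂ (trans F₁≡b₁ (sym g₁≡b₁))) ,
  λ b₁<F₁ →
    at (λ B → F₁₃ ≤ F₃ * (B + 1)) F₁₃≤F₃[g₁+1] ,
    g₁<F₁⇒F₁₂≤g₂F₁ (subst (_< F₁) (sym g₁≡b₁) b₁<F₁) ,
    at (λ B → F₁₂ ≤ g₂ * (B + 1)) F₁₂≤g₂[g₁+1] ,
    at (λ B → F₂₃ ≤ g₂ * (F₁₃ div B + 1)) F₂₃≤g₂[F₁₃div-g₁+1] ,
    F₂₃≤g₂F₃ ,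
    at (λ B → g₂ * B ≤ F₁₂) (subst (_≤ F₁₂) (*-comm g₁ g₂) g₁g₂≤F₁₂) ,
    at (λ B → g₂ * (F₁₃ cdiv (B + 1) ∸ 1) ≤ F₂₃) g₂[F₁₃cdiv[g₁+1]∸1]≤F₂₃ ,
    g≤fΔ₁ c₂
  where
  open Estimates Δ P Γ∈𝒜 tight r≡2
  -- Rewriting the whole goal with g₁≡b₁ makes Agda unfold the face counts; this is far cheaper.
  at : (C : ℕ → Set) → C g₁ → C (b c₁ Δ)
  at C = subst C g₁≡b₁
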